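{- Fix $k\geq 1$. For $n\geq 1$ let $u,v$ be chosen independently and uniformly at random from $\Sigma_k^n$. Then the expected value of $\operatorname{lso}(u,v)$ is $O(1)$, i.e., bounded by a constant independent of $n$.
   Context: $\Sigma_k=\{0,1,\ldots,k-1\}$ and $\Sigma_k^n$ is the set of length-$n$ words over $\Sigma_k$. A right-border of a pair $(u,v)$ is a non-empty word that is a proper suffix of $u$ and a proper prefix of $v$. $\operatorname{lso}(u,v)$ is the length of the shortest right-border of $(u,v)$, and $\operatorname{lso}(u,v)=0$ if $(u,v)$ has no right-border. -}

module Defs where

open import Data.Nat using (ℕ; zero; suc; _∸_; _<?_)
open import Data.Nat.Properties using () 
open import Data.Fin using (Fin)
open import Data.Fin.Properties using () renaming (_≟_ to _≟ᶠ_)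
open import Data.List using (List; []; _∷_; length; take; drop; map; filter; upTo; concatMap; allFin)
open import Data.Nat.ListAction using (sum)
open import Data.List.Properties using (≡-dec)
open import Data.Product using (_×_)
open import Relation.Nullary using (Dec)
open import Relation.Nullary.Decidable using (_×-dec_)
open import Relation.Binary.PropositionalEquality using (_≡_)

Word : ℕ → Set
Word k = List (Fin k)

-- ℓ is the length of a right-border of (u , v): the length-ℓ suffix of u
-- equals the length-ℓ prefix of v, with 1 ≤ ℓ < |u| and ℓ < |v|
-- (non-empty, proper suffix of u, proper prefix of v).
-- Here we only check ℓ < |v| and suffix = prefix; ℓ ranges over 1..|u|-1 below.
border? : {k : ℕ} (u v : Word k) (ℓ : ℕ) →
          Dec ((ℓ Data.Nat.< length v) × (drop (length u ∸ ℓ) u ≡ take ℓ v))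
border? u v ℓ = (ℓ <? length v) ×-dec ≡-dec _≟ᶠ_ (drop (length u ∸ ℓ) u) (take ℓ v)

borderLengths : {k : ℕ} (u v : Word k) → List ℕ
borderLengths u v = filter (border? u v) (map suc (upTo (length u ∸ 1)))

-- lso(u,v): length of the shortest right-border, 0 if there is none.
lso : {k : ℕ} (u v : Word k) → ℕ
lso u v with borderLengths u v
... | []    = 0
... | ℓ ∷ _ = ℓ

words : (k n : ℕ) → List (Word k)
words k zero    = [] ∷ []
words k (suc n) = concatMap (λ a → map (a ∷_) (words k n)) (allFin k)

-- Σ_{u,v ∈ Σ_k^n} lso(u,v); the expected value of lso(u,v) for uniform
-- independent u,v is this total divided by k^(2n).
totalLso : (k n : ℕ) → ℕ
totalLso k n = sum (concatMap (λ u → map (lso u) (words k n)) (words k n))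

-- For u of length n, lso(u,v) is at most the sum of the lengths of all right-borders
-- of (u,v), and the ℓ-suffix of u is the ℓ-prefix of at most k^(n-ℓ) words v of length n.
-- Hence Σ_v lso(u,v) ≤ Σ_{ℓ≥1} ℓ k^(n-ℓ) ≤ 2 k^n when k ≥ 2, and summing over u gives
-- 2 k^(2n). For k = 1 all words of a given length coincide and lso ≤ 1, since 1 is a
-- right-border as soon as |u| ≥ 2.
module Submission where

open import Defs
open import Level using (0ℓ)
open import Data.Nat using (ℕ; zero; suc; _+_; _*_; _^_; _∸_; _≤_; z≤n; s≤s)
open import Data.Nat.Properties
  using ( ≤-refl; ≤-reflexive; ≤-trans; ≤-antisym; n≤1+n; m≤m+n; m∸n≤m; +-∸-assoc; +-identityʳ
        ; *-identityʳ; *-zeroʳ; *-comm; *-assoc; *-distribˡ-+; ^-distribˡ-+-*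
        ; +-mono-≤; +-monoˡ-≤; +-monoʳ-≤; *-monoˡ-≤; *-monoʳ-≤; module ≤-Reasoning )
open import Data.Nat.ListAction using (sum)
open import Data.Nat.ListAction.Properties using (sum-++)
open import Data.Nat.Tactic.RingSolver using (solve-∀)
open import Data.Fin using (Fin) renaming (zero to fzero; suc to fsuc)
open import Data.Fin.Properties using () renaming (_≟_ to _≟ᶠ_; suc-injective to fsuc-injective)
open import Data.List using (List; []; _∷_; _++_; length; take; drop; map; filter; upTo; concatMap; allFin)
open import Data.List.Properties
  using (≡-dec; ∷-injectiveˡ; ∷-injectiveʳ; map-id; map-++; map-tabulate; length-tabulate; upTo-∷ʳ; filter-accept)
open import Data.Product using (∃-syntax; _,_; proj₂)
open import Relation.Nullary using (Dec; yes; no; ¬_; contradiction)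
open import Relation.Unary using (Pred; Decidable)
open import Relation.Binary.PropositionalEquality using (_≡_; refl; sym; trans; cong; cong₂; subst; module ≡-Reasoning)

∑ : {A : Set} → List A → (A → ℕ) → ℕ
∑ xs f = sum (map f xs)

infix 5 ∑
syntax ∑ xs (λ x → e) = ∑[ x ∈ xs ] e

∑-++ : {A : Set} (xs ys : List A) (f : A → ℕ) → ∑ (xs ++ ys) f ≡ ∑ xs f + ∑ ys f
∑-++ xs ys f = trans (cong sum (map-++ f xs ys)) (sum-++ (map f xs) (map f ys))

∑-cong : {A : Set} (xs : List A) {f g : A → ℕ} → (∀ x → f x ≡ g x) → ∑ xs f ≡ ∑ xs g
∑-cong []       f≗g = refl
∑-cong (x ∷ xs) f≗g = cong₂ _+_ (f≗g x) (∑-cong xs f≗g)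

∑-mono : {A : Set} (xs : List A) {f g : A → ℕ} → (∀ x → f x ≤ g x) → ∑ xs f ≤ ∑ xs g
∑-mono []       f≤g = z≤n
∑-mono (x ∷ xs) f≤g = +-mono-≤ (f≤g x) (∑-mono xs f≤g)

∑-zero : {A : Set} (xs : List A) {f : A → ℕ} → (∀ x → f x ≡ 0) → ∑ xs f ≡ 0
∑-zero []       f≗0 = refl
∑-zero (x ∷ xs) f≗0 = cong₂ _+_ (f≗0 x) (∑-zero xs f≗0)

∑-const : {A : Set} (xs : List A) (c : ℕ) → ∑[ _ ∈ xs ] c ≡ length xs * c
∑-const []       c = refl
∑-const (x ∷ xs) c = cong (c +_) (∑-const xs c)

∑-distrib-+ : {A : Set} (xs : List A) (f g : A → ℕ) → ∑[ x ∈ xs ] (f x + g x) ≡ ∑ xs f + ∑ xs g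
∑-distrib-+ []       f g = refl
∑-distrib-+ (x ∷ xs) f g = begin
  f x + g x + (∑[ y ∈ xs ] (f y + g y)) ≡⟨ cong (f x + g x +_) (∑-distrib-+ xs f g) ⟩
  f x + g x + (∑ xs f + ∑ xs g)         ≡⟨ interchange (f x) (g x) (∑ xs f) (∑ xs g) ⟩
  f x + ∑ xs f + (g x + ∑ xs g)         ∎
  where
  open ≡-Reasoning
  interchange : ∀ a b c d → a + b + (c + d) ≡ a + c + (b + d)
  interchange = solve-∀

∑-*ˡ : {A : Set} (xs : List A) (c : ℕ) (f : A → ℕ) → ∑[ x ∈ xs ] c * f x ≡ c * ∑ xs f
∑-*ˡ []       c f = sym (*-zeroʳ c)
∑-*ˡ (x ∷ xs) c f = trans (cong (c * f x +_) (∑-*ˡ xs c f)) (sym (*-distribˡ-+ c (f x) (∑ xs f)))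

∑-comm : {A B : Set} (xs : List A) (ys : List B) (f : A → B → ℕ) →
         ∑[ x ∈ xs ] ∑[ y ∈ ys ] f x y ≡ ∑[ y ∈ ys ] ∑[ x ∈ xs ] f x y
∑-comm xs []       f = ∑-zero xs (λ _ → refl)
∑-comm xs (y ∷ ys) f =
  trans (∑-distrib-+ xs (λ x → f x y) (λ x → ∑[ y′ ∈ ys ] f x y′))
        (cong ((∑[ x ∈ xs ] f x y) +_) (∑-comm xs ys f))

∑-map : {A B : Set} (xs : List A) (g : A → B) (f : B → ℕ) → ∑ (map g xs) f ≡ ∑[ x ∈ xs ] f (g x)
∑-map []       g f = refl
∑-map (x ∷ xs) g f = cong (f (g x) +_) (∑-map xs g f)

∑-concatMap : {A B : Set} (xs : List A) (g : A → List B) (f : B → ℕ) →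
              ∑ (concatMap g xs) f ≡ ∑[ x ∈ xs ] ∑ (g x) f
∑-concatMap []       g f = refl
∑-concatMap (x ∷ xs) g f =
  trans (∑-++ (g x) (concatMap g xs) f) (cong (∑ (g x) f +_) (∑-concatMap xs g f))

∑-upTo-suc : (m : ℕ) (f : ℕ → ℕ) →
             ∑ (map suc (upTo (suc m))) f ≡ ∑ (map suc (upTo m)) f + f (suc m)
∑-upTo-suc m f = begin
  ∑ (map suc (upTo (suc m))) f            ≡⟨ cong (λ xs → ∑ (map suc xs) f) (upTo-∷ʳ m) ⟨
  ∑ (map suc (upTo m ++ m ∷ [])) f        ≡⟨ cong (λ xs → ∑ xs f) (map-++ suc (upTo m) (m ∷ [])) ⟩
  ∑ (map suc (upTo m) ++ suc m ∷ []) f    ≡⟨ ∑-++ (map suc (upTo m)) (suc m ∷ []) f ⟩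
  ∑ (map suc (upTo m)) f + (f (suc m) + 0) ≡⟨ cong (∑ (map suc (upTo m)) f +_) (+-identityʳ (f (suc m))) ⟩
  ∑ (map suc (upTo m)) f + f (suc m)       ∎
  where open ≡-Reasoning

∑-allFin-suc : ∀ {k} (f : Fin (suc k) → ℕ) → ∑ (allFin (suc k)) f ≡ f fzero + (∑[ a ∈ allFin k ] f (fsuc a))
∑-allFin-suc {k} f = cong (f fzero +_)
  (trans (cong sum (map-tabulate fsuc f)) (cong sum (sym (map-tabulate {n = k} (λ a → a) (λ a → f (fsuc a))))))

∑-allFin-point : ∀ {k} (b : Fin k) (f : Fin k → ℕ) → (∀ a → ¬ a ≡ b → f a ≡ 0) → ∑ (allFin k) f ≡ f b
∑-allFin-point {suc k} fzero f off-b = begin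
  ∑ (allFin (suc k)) f                     ≡⟨ ∑-allFin-suc f ⟩
  f fzero + (∑[ a ∈ allFin k ] f (fsuc a)) ≡⟨ cong (f fzero +_) (∑-zero (allFin k) (λ a → off-b (fsuc a) λ ())) ⟩
  f fzero + 0                              ≡⟨ +-identityʳ (f fzero) ⟩
  f fzero                                  ∎
  where open ≡-Reasoning
∑-allFin-point {suc k} (fsuc b) f off-b = begin
  ∑ (allFin (suc k)) f                     ≡⟨ ∑-allFin-suc f ⟩
  f fzero + (∑[ a ∈ allFin k ] f (fsuc a)) ≡⟨ cong₂ _+_ (off-b fzero λ ()) (∑-allFin-point b (λ a → f (fsuc a)) off-b′) ⟩
  f (fsuc b)                               ∎
  where
  open ≡-Reasoning
  off-b′ : ∀ a → ¬ a ≡ b → f (fsuc a) ≡ 0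
  off-b′ a a≢b = off-b (fsuc a) (λ eq → a≢b (fsuc-injective eq))

𝟙 : {P : Set} → Dec P → ℕ
𝟙 (yes _) = 1
𝟙 (no _)  = 0

𝟙≤1 : {P : Set} (p? : Dec P) → 𝟙 p? ≤ 1
𝟙≤1 (yes _) = s≤s z≤n
𝟙≤1 (no _)  = z≤n

𝟙-reject : {P : Set} (p? : Dec P) → ¬ P → 𝟙 p? ≡ 0
𝟙-reject (yes p) ¬p = contradiction p ¬p
𝟙-reject (no _)  ¬p = refl

𝟙-mono : {P Q : Set} (p? : Dec P) (q? : Dec Q) → (P → Q) → 𝟙 p? ≤ 𝟙 q?
𝟙-mono (yes p) (yes _) P⇒Q = ≤-refl
𝟙-mono (yes p) (no ¬q) P⇒Q = contradiction (P⇒Q p) ¬q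
𝟙-mono (no _)  q?      P⇒Q = z≤n

𝟙-cong : {P Q : Set} (p? : Dec P) (q? : Dec Q) → (P → Q) → (Q → P) → 𝟙 p? ≡ 𝟙 q?
𝟙-cong p? q? P⇒Q Q⇒P = ≤-antisym (𝟙-mono p? q? P⇒Q) (𝟙-mono q? p? Q⇒P)

sum-filter : {P : Pred ℕ 0ℓ} (P? : Decidable P) (xs : List ℕ) →
             sum (filter P? xs) ≡ ∑[ x ∈ xs ] x * 𝟙 (P? x)
sum-filter P? []       = refl
sum-filter P? (x ∷ xs) with P? x
... | yes _ = cong₂ _+_ (sym (*-identityʳ x)) (sum-filter P? xs)
... | no _  = trans (sum-filter P? xs) (cong (_+ (∑[ y ∈ xs ] y * 𝟙 (P? y))) (sym (*-zeroʳ x)))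

∑-words-suc : ∀ k n (f : Word k → ℕ) →
              ∑ (words k (suc n)) f ≡ ∑[ a ∈ allFin k ] ∑[ v ∈ words k n ] f (a ∷ v)
∑-words-suc k n f = trans (∑-concatMap (allFin k) (λ a → map (a ∷_) (words k n)) f)
                          (∑-cong (allFin k) (λ a → ∑-map (words k n) (a ∷_) f))

∑-words-≤ : ∀ k n (f : Word k → ℕ) (B : ℕ) → (∀ u → length u ≡ n → f u ≤ B) →
            ∑ (words k n) f ≤ k ^ n * B
∑-words-≤ k zero    f B f≤B = +-monoˡ-≤ 0 (f≤B [] refl)
∑-words-≤ k (suc n) f B f≤B = begin
  ∑ (words k (suc n)) f                          ≡⟨ ∑-words-suc k n f ⟩
  ∑[ a ∈ allFin k ] ∑[ v ∈ words k n ] f (a ∷ v) ≤⟨ ∑-mono (allFin k) (λ a → ∑-words-≤ k n _ B (λ u eq → f≤B (a ∷ u) (cong suc eq))) ⟩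
  ∑[ _ ∈ allFin k ] k ^ n * B                     ≡⟨ ∑-const (allFin k) (k ^ n * B) ⟩
  length (allFin k) * (k ^ n * B)                ≡⟨ cong (_* (k ^ n * B)) (length-tabulate {n = k} (λ a → a)) ⟩
  k * (k ^ n * B)                                ≡⟨ *-assoc k (k ^ n) B ⟨
  k ^ suc n * B                                  ∎
  where open ≤-Reasoning

infix 4 _≟ʷ_
_≟ʷ_ : ∀ {k} (u v : Word k) → Dec (u ≡ v)
_≟ʷ_ = ≡-dec _≟ᶠ_

∑-prefix-≤ : ∀ k n ℓ (w : Word k) → ∑[ v ∈ words k n ] 𝟙 (w ≟ʷ take ℓ v) ≤ k ^ (n ∸ ℓ)
∑-prefix-≤ k n       zero    w  =
  ≤-trans (∑-words-≤ k n _ 1 (λ _ _ → 𝟙≤1 (w ≟ʷ []))) (≤-reflexive (*-identityʳ (k ^ n)))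
∑-prefix-≤ k zero    (suc ℓ) w  = +-monoˡ-≤ 0 (𝟙≤1 (w ≟ʷ []))
∑-prefix-≤ k (suc n) (suc ℓ) [] = ≤-trans (≤-reflexive no-match) z≤n
  where
  no-match : ∑[ v ∈ words k (suc n) ] 𝟙 ([] ≟ʷ take (suc ℓ) v) ≡ 0
  no-match = trans (∑-words-suc k n _)
    (∑-zero (allFin k) (λ a → ∑-zero (words k n) (λ v → 𝟙-reject ([] ≟ʷ a ∷ take ℓ v) λ ())))
∑-prefix-≤ k (suc n) (suc ℓ) (b ∷ w) = begin
  ∑[ v ∈ words k (suc n) ] 𝟙 (b ∷ w ≟ʷ take (suc ℓ) v)           ≡⟨ ∑-words-suc k n _ ⟩
  ∑[ a ∈ allFin k ] ∑[ v ∈ words k n ] 𝟙 (b ∷ w ≟ʷ a ∷ take ℓ v) ≡⟨ ∑-allFin-point b _ other-heads-vanish ⟩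
  ∑[ v ∈ words k n ] 𝟙 (b ∷ w ≟ʷ b ∷ take ℓ v)                   ≡⟨ ∑-cong (words k n) drop-head ⟩
  ∑[ v ∈ words k n ] 𝟙 (w ≟ʷ take ℓ v)                           ≤⟨ ∑-prefix-≤ k n ℓ w ⟩
  k ^ (n ∸ ℓ)                                                    ∎
  where
  open ≤-Reasoning
  other-heads-vanish : ∀ a → ¬ a ≡ b → ∑[ v ∈ words k n ] 𝟙 (b ∷ w ≟ʷ a ∷ take ℓ v) ≡ 0
  other-heads-vanish a a≢b =
    ∑-zero (words k n) (λ v → 𝟙-reject (b ∷ w ≟ʷ a ∷ take ℓ v) (λ eq → a≢b (sym (∷-injectiveˡ eq))))
  drop-head : ∀ v → 𝟙 (b ∷ w ≟ʷ b ∷ take ℓ v) ≡ 𝟙 (w ≟ʷ take ℓ v)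
  drop-head v = 𝟙-cong (b ∷ w ≟ʷ b ∷ take ℓ v) (w ≟ʷ take ℓ v) ∷-injectiveʳ (cong (b ∷_))

-- The correction term makes this an equality for k = 2: Σ_{ℓ≤m} ℓ 2^-ℓ = 2 − (m + 2) 2^-m.
∑-ℓk^[n∸ℓ]-≤ : ∀ {k} → 2 ≤ k → ∀ m n → m ≤ n →
               (∑[ ℓ ∈ map suc (upTo m) ] ℓ * k ^ (n ∸ ℓ)) + (m + 2) * k ^ (n ∸ m) ≤ 2 * k ^ n
∑-ℓk^[n∸ℓ]-≤ k≥2 zero    n _   = ≤-refl
∑-ℓk^[n∸ℓ]-≤ {k} k≥2 (suc m) n m<n = begin
  (∑[ ℓ ∈ map suc (upTo (suc m)) ] ℓ * k ^ (n ∸ ℓ)) + (suc m + 2) * e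
    ≡⟨ cong (_+ (suc m + 2) * e) (∑-upTo-suc m (λ ℓ → ℓ * k ^ (n ∸ ℓ))) ⟩
  Σₘ + suc m * e + (suc m + 2) * e   ≡⟨ regroup Σₘ m e ⟩
  Σₘ + (m + 2) * (2 * e)             ≤⟨ +-monoʳ-≤ Σₘ (*-monoʳ-≤ (m + 2) (*-monoˡ-≤ e k≥2)) ⟩
  Σₘ + (m + 2) * (k * e)             ≡⟨ cong (λ i → Σₘ + (m + 2) * k ^ i) (+-∸-assoc 1 m<n) ⟨
  Σₘ + (m + 2) * k ^ (n ∸ m)         ≤⟨ ∑-ℓk^[n∸ℓ]-≤ k≥2 m n (≤-trans (n≤1+n m) m<n) ⟩
  2 * k ^ n                          ∎
  where
  open ≤-Reasoning
  e  = k ^ (n ∸ suc m)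
  Σₘ = ∑[ ℓ ∈ map suc (upTo m) ] ℓ * k ^ (n ∸ ℓ)
  regroup : ∀ a m e → a + suc m * e + (suc m + 2) * e ≡ a + (m + 2) * (2 * e)
  regroup = solve-∀

lso≤sum-borderLengths : ∀ {k} (u v : Word k) → lso u v ≤ sum (borderLengths u v)
lso≤sum-borderLengths u v with borderLengths u v
... | []     = z≤n
... | ℓ ∷ ℓs = m≤m+n ℓ (sum ℓs)

lso≡head : ∀ {k} (u v : Word k) {ℓ ℓs} → borderLengths u v ≡ ℓ ∷ ℓs → lso u v ≡ ℓ
lso≡head u v eq with borderLengths u v
lso≡head u v refl | _ = refl

sum-borderLengths-≤ : ∀ {k} (u v : Word k) →
  sum (borderLengths u v) ≤ ∑[ ℓ ∈ map suc (upTo (length u ∸ 1)) ] ℓ * 𝟙 (drop (length u ∸ ℓ) u ≟ʷ take ℓ v)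
sum-borderLengths-≤ u v = begin
  sum (borderLengths u v)                   ≡⟨ sum-filter (border? u v) L ⟩
  ∑[ ℓ ∈ L ] ℓ * 𝟙 (border? u v ℓ)          ≤⟨ ∑-mono L (λ ℓ → *-monoʳ-≤ ℓ (𝟙-mono (border? u v ℓ) (D ℓ ≟ʷ take ℓ v) proj₂)) ⟩
  ∑[ ℓ ∈ L ] ℓ * 𝟙 (D ℓ ≟ʷ take ℓ v)        ∎
  where
  open ≤-Reasoning
  L = map suc (upTo (length u ∸ 1))
  D = λ ℓ → drop (length u ∸ ℓ) u

∑-lso-≤-of-2≤k : ∀ {k} → 2 ≤ k → ∀ n (u : Word k) → length u ≡ n → ∑[ v ∈ words k n ] lso u v ≤ 2 * k ^ n
∑-lso-≤-of-2≤k {k} k≥2 n u ∣u∣≡n = begin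
  ∑[ v ∈ W ] lso u v                                  ≤⟨ ∑-mono W (λ v → ≤-trans (lso≤sum-borderLengths u v) (sum-borderLengths-≤ u v)) ⟩
  ∑[ v ∈ W ] ∑[ ℓ ∈ L ] ℓ * 𝟙 (D ℓ ≟ʷ take ℓ v)       ≡⟨ ∑-comm W L (λ v ℓ → ℓ * 𝟙 (D ℓ ≟ʷ take ℓ v)) ⟩
  ∑[ ℓ ∈ L ] ∑[ v ∈ W ] ℓ * 𝟙 (D ℓ ≟ʷ take ℓ v)       ≡⟨ ∑-cong L (λ ℓ → ∑-*ˡ W ℓ (λ v → 𝟙 (D ℓ ≟ʷ take ℓ v))) ⟩
  ∑[ ℓ ∈ L ] ℓ * (∑[ v ∈ W ] 𝟙 (D ℓ ≟ʷ take ℓ v))     ≤⟨ ∑-mono L (λ ℓ → *-monoʳ-≤ ℓ (∑-prefix-≤ k n ℓ (D ℓ))) ⟩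
  ∑[ ℓ ∈ L ] ℓ * k ^ (n ∸ ℓ)                          ≤⟨ m≤m+n _ _ ⟩
  (∑[ ℓ ∈ L ] ℓ * k ^ (n ∸ ℓ)) + (m + 2) * k ^ (n ∸ m) ≤⟨ ∑-ℓk^[n∸ℓ]-≤ k≥2 m n m≤n ⟩
  2 * k ^ n                                           ∎
  where
  open ≤-Reasoning
  W = words k n
  m = length u ∸ 1
  L = map suc (upTo m)
  D = λ ℓ → drop (length u ∸ ℓ) u
  m≤n : m ≤ n
  m≤n = ≤-trans (m∸n≤m (length u) 1) (≤-reflexive ∣u∣≡n)

drop-length-unary : (u : Word 1) → drop (length u) (fzero ∷ u) ≡ fzero ∷ []
drop-length-unary []          = refl
drop-length-unary (fzero ∷ u) = drop-length-unary u

lso-unary-≤1 : (u v : Word 1) → length u ≡ length v → lso u v ≤ 1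
lso-unary-≤1 []                     v                     _  = z≤n
lso-unary-≤1 (_ ∷ [])               v                     _  = z≤n
lso-unary-≤1 (_ ∷ _ ∷ _)            []                    ()
lso-unary-≤1 (_ ∷ _ ∷ _)            (_ ∷ [])              ()
lso-unary-≤1 u@(fzero ∷ fzero ∷ u′) v@(fzero ∷ _ ∷ _)     _  =
  ≤-reflexive (lso≡head u v (filter-accept (border? u v) (s≤s (s≤s z≤n) , drop-length-unary u′)))

∑-lso-≤ : ∀ {k} → 1 ≤ k → ∀ n (u : Word k) → length u ≡ n → ∑[ v ∈ words k n ] lso u v ≤ 2 * k ^ n
∑-lso-≤ {1} _ n u ∣u∣≡n = begin
  ∑[ v ∈ words 1 n ] lso u v ≤⟨ ∑-words-≤ 1 n (lso u) 1 (λ v ∣v∣≡n → lso-unary-≤1 u v (trans ∣u∣≡n (sym ∣v∣≡n))) ⟩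
  1 ^ n * 1                  ≡⟨ *-comm (1 ^ n) 1 ⟩
  1 * 1 ^ n                  ≤⟨ *-monoˡ-≤ (1 ^ n) (s≤s {0} {1} z≤n) ⟩
  2 * 1 ^ n                  ∎
  where open ≤-Reasoning
∑-lso-≤ {suc (suc k)} _ = ∑-lso-≤-of-2≤k (s≤s (s≤s z≤n))

totalLso≡∑∑lso : ∀ k n → totalLso k n ≡ ∑[ u ∈ words k n ] ∑[ v ∈ words k n ] lso u v
totalLso≡∑∑lso k n = begin
  sum (concatMap (λ u → map (lso u) W) W)              ≡⟨ cong sum (map-id (concatMap (λ u → map (lso u) W) W)) ⟨
  ∑[ x ∈ concatMap (λ u → map (lso u) W) W ] x          ≡⟨ ∑-concatMap W (λ u → map (lso u) W) (λ x → x) ⟩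
  ∑[ u ∈ W ] ∑[ x ∈ map (lso u) W ] x                   ≡⟨ ∑-cong W (λ u → ∑-map W (lso u) (λ x → x)) ⟩
  ∑[ u ∈ W ] ∑[ v ∈ W ] lso u v                          ∎
  where
  open ≡-Reasoning
  W = words k n

kⁿ*2kⁿ≡2k²ⁿ : ∀ k n → k ^ n * (2 * k ^ n) ≡ 2 * k ^ (2 * n)
kⁿ*2kⁿ≡2k²ⁿ k n = begin
  k ^ n * (2 * k ^ n) ≡⟨ swap (k ^ n) ⟩
  2 * (k ^ n * k ^ n) ≡⟨ cong (2 *_) (^-distribˡ-+-* k n n) ⟨
  2 * k ^ (n + n)     ≡⟨ cong (λ i → 2 * k ^ (n + i)) (+-identityʳ n) ⟨
  2 * k ^ (2 * n)     ∎
  where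
  open ≡-Reasoning
  swap : ∀ a → a * (2 * a) ≡ 2 * (a * a)
  swap = solve-∀

theorem14 : (k : ℕ) → 1 ≤ k →
    ∃[ C ] ((n : ℕ) → 1 ≤ n → totalLso k n ≤ C * k ^ (2 * n))
theorem14 k k≥1 = 2 , λ n _ → begin
  totalLso k n                                    ≡⟨ totalLso≡∑∑lso k n ⟩
  ∑[ u ∈ words k n ] ∑[ v ∈ words k n ] lso u v   ≤⟨ ∑-words-≤ k n _ (2 * k ^ n) (∑-lso-≤ k≥1 n) ⟩
  k ^ n * (2 * k ^ n)                             ≡⟨ kⁿ*2kⁿ≡2k²ⁿ k n ⟩
  2 * k ^ (2 * n)                                 ∎
  where open ≤-Reasoning
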